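{- For a split graph $G$, the following are equivalent: (1) $G$ is an NG-graph; (2) $G$ is an NG-1 graph or an NG-2 graph; (3) $G$ is unbalanced.
   Context: All graphs are finite and simple; $\chi$ is chromatic number, $\omega$ clique number, $\alpha$ independence number, $\overline{G}$ the complement. A graph $G$ is an NG-graph if $\chi(G)+\chi(\overline{G})=|V(G)|+1$. The ABC-partition of $V(G)$ is $A=\{v:\deg(v)=\chi(G)-1\}$, $B=\{v:\deg(v)>\chi(G)-1\}$, $C=\{v:\deg(v)<\chi(G)-1\}$. An NG-graph is NG-1 if $G[A]$ is a clique, NG-2 if $G[A]$ is a stable set. A split graph is one whose vertex set has a KS-partition $V(G)=K\cup S$ (disjoint) with $K$ a clique and $S$ a stable set. A split graph is balanced if it has a KS-partition with $|K|=\omega(G)$ and $|S|=\alpha(G)$, and unbalanced otherwise. -}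

module Defs where

open import Data.Nat using (ℕ; zero; suc; _+_; _≤_)
open import Data.Fin using (Fin; _≟_)
open import Data.Bool using (Bool; true; false; not; if_then_else_)
open import Data.Vec using (tabulate)
open import Data.Fin.Subset using (Subset; _∈_; _∉_; ∁; ∣_∣)
open import Data.Product using (Σ; _×_; ∃; ∃-syntax; _,_)
open import Data.Sum using (_⊎_)
open import Data.Empty using (⊥-elim)
open import Relation.Nullary using (¬_; yes; no)
open import Relation.Binary.PropositionalEquality using (_≡_; _≢_; refl; sym)

record Graph (n : ℕ) : Set where
  field
    adj    : Fin n → Fin n → Bool
    adj-sym    : ∀ i j → adj i j ≡ adj j i
    adj-irrefl : ∀ i → adj i i ≡ false
open Graph public

cadj : ∀ {n} → Graph n → Fin n → Fin n → Bool
cadj G i j with i ≟ j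
... | yes _ = false
... | no  _ = not (adj G i j)

cadj-sym : ∀ {n} (G : Graph n) i j → cadj G i j ≡ cadj G j i
cadj-sym G i j with i ≟ j | j ≟ i
... | yes _ | yes _ = refl
... | yes p | no q  = ⊥-elim (q (sym p))
... | no p  | yes q = ⊥-elim (p (sym q))
... | no _  | no _  rewrite adj-sym G i j = refl

cadj-irrefl : ∀ {n} (G : Graph n) i → cadj G i i ≡ false
cadj-irrefl G i with i ≟ i
... | yes _ = refl
... | no p  = ⊥-elim (p refl)

complement : ∀ {n} → Graph n → Graph n
complement G = record { adj = cadj G ; adj-sym = cadj-sym G ; adj-irrefl = cadj-irrefl G }

deg : ∀ {n} → Graph n → Fin n → ℕ
deg G i = ∣ tabulate (adj G i) ∣

Colouring : ∀ {n} → Graph n → ℕ → Set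
Colouring {n} G k = Σ (Fin n → Fin k) λ c → ∀ i j → adj G i j ≡ true → c i ≢ c j

IsChromaticNumber : ∀ {n} → Graph n → ℕ → Set
IsChromaticNumber G k = Colouring G k × (∀ m → Colouring G m → k ≤ m)

IsClique : ∀ {n} → Graph n → Subset n → Set
IsClique G K = ∀ i j → i ∈ K → j ∈ K → i ≢ j → adj G i j ≡ true

IsStable : ∀ {n} → Graph n → Subset n → Set
IsStable G S = ∀ i j → i ∈ S → j ∈ S → adj G i j ≡ false

IsCliqueNumber : ∀ {n} → Graph n → ℕ → Set
IsCliqueNumber G w = (∃[ K ] (IsClique G K × ∣ K ∣ ≡ w)) × (∀ K → IsClique G K → ∣ K ∣ ≤ w)

IsIndependenceNumber : ∀ {n} → Graph n → ℕ → Set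
IsIndependenceNumber G a = (∃[ S ] (IsStable G S × ∣ S ∣ ≡ a)) × (∀ S → IsStable G S → ∣ S ∣ ≤ a)

IsNG : ∀ {n} → Graph n → Set
IsNG {n} G = ∃[ k ] ∃[ l ] (IsChromaticNumber G k × IsChromaticNumber (complement G) l × k + l ≡ n + 1)

-- the set A of the ABC-partition, for χ(G) = k : deg v = k - 1
InA : ∀ {n} → Graph n → ℕ → Fin n → Set
InA G k v = deg G v + 1 ≡ k

IsNG1 : ∀ {n} → Graph n → Set
IsNG1 G = IsNG G × (∀ k → IsChromaticNumber G k →
            ∀ u v → InA G k u → InA G k v → u ≢ v → adj G u v ≡ true)

IsNG2 : ∀ {n} → Graph n → Set
IsNG2 G = IsNG G × (∀ k → IsChromaticNumber G k →
            ∀ u v → InA G k u → InA G k v → adj G u v ≡ false)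

IsKSPartition : ∀ {n} → Graph n → Subset n → Set
IsKSPartition G K = IsClique G K × IsStable G (∁ K)

IsSplit : ∀ {n} → Graph n → Set
IsSplit G = ∃[ K ] IsKSPartition G K

IsBalanced : ∀ {n} → Graph n → Set
IsBalanced G = IsSplit G × (∃[ K ] (IsKSPartition G K
                 × IsCliqueNumber G ∣ K ∣ × IsIndependenceNumber G ∣ ∁ K ∣))

IsUnbalanced : ∀ {n} → Graph n → Set
IsUnbalanced G = IsSplit G × ¬ IsBalanced G

-- Fix a KS-partition V = K ∪ S.  Either (after possibly moving one vertex of K
-- with no neighbour in S over to S) some s ∈ S is adjacent to all of K, or the
-- partition is tight: every vertex of S misses some vertex of K and every
-- vertex of K sees some vertex of S (splitShape).  Both chromatic numbers come
-- from one fact (splitChromatic): if C is a clique with stable complement and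
-- every vertex outside C has a non-neighbour in C, then χ = |C|.
--  * Dominating s: K ∪ {s} is a clique, χ(G) = |K| + 1 and χ(Ḡ) = |S|, so G is
--    NG; ω + α ≥ n + 1 makes G unbalanced; a degree count shows A ⊆ K ∪ {s}
--    or A ⊆ S, i.e. G is NG-1 or NG-2 (module Dominated).
--  * Tight: χ(G) = ω = |K| and χ(Ḡ) = α = |S|, so G is balanced and
--    χ(G) + χ(Ḡ) = n, not NG (module TightSplit).

module Submission where

open import Defs
import Data.Nat as ℕ
open import Data.Nat using (zero; suc; _+_; _≤_; _<_)
open import Data.Fin using (Fin; zero; suc; _≟_)
open import Data.Bool using (true; false)
open import Data.Vec using (_∷_; here; there; tabulate)
open import Data.Vec.Properties using (lookup∘tabulate; []=⇒lookup; lookup⇒[]=)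
open import Data.Fin.Subset using (Subset; _∈_; _∉_; ∁; ∣_∣; _∪_; _-_; ⁅_⁆)
open import Data.Fin.Subset.Properties
  using (∪-identityʳ; p─⊥≡p; p─q⊆p; x∈p∧x≢y⇒x∈p-y; ∣∁p∣≡n∸∣p∣; ∣p∣≤n; x∈p⇒∣p-x∣<∣p∣; x∈p∪q⁻; x∈p∪q⁺; x∈⁅x⁆; x∈⁅y⁆⇒x≡y; _∈?_; x∉p⇒x∈∁p; x∈∁p⇒x∉p; x∉∁p⇒x∈p; p⊆q⇒∣p∣≤∣q∣)
import Data.Fin.Properties as FinP
open FinP using (injective⇒≤)
open import Data.Nat.Properties using (≤-antisym; m+[n∸m]≡n; +-mono-≤; ≤-<-trans; +-comm; suc-injective; <-irrefl; 1+n≰n; ≤-reflexive)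
open import Data.Product using (_×_; _,_; proj₁; proj₂; ∃-syntax)
open import Data.Sum using (_⊎_; inj₁; inj₂; map₂; swap; [_,_])
open import Data.Empty using (⊥; ⊥-elim)
open import Function using (_∘_)
open import Function.Bundles using (_⇔_; mk⇔)
open import Relation.Nullary using (¬_; Dec; yes; no; contradiction; ¬?)
open import Relation.Nullary.Decidable using (toSum)
open import Relation.Unary using (Decidable)
open import Relation.Binary.PropositionalEquality using (_≡_; _≢_; refl; sym; trans; cong; cong₂; subst; module ≡-Reasoning)
open ≡-Reasoning

true-or-false : ∀ b → b ≡ true ⊎ b ≡ false
true-or-false true  = inj₁ refl
true-or-false false = inj₂ refl

true≢false : ∀ {b} → b ≡ true → b ≡ false → ⊥
true≢false refl ()

allOrSome : ∀ {n} {A P Q : Fin n → Set} → Decidable A → (∀ i → A i → P i ⊎ Q i) →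
            (∀ i → A i → P i) ⊎ ∃[ i ] (A i × Q i)
allOrSome {zero} _ _ = inj₁ λ ()
allOrSome {suc n} A? choose with allOrSome (A? ∘ suc) (choose ∘ suc) | A? zero
... | inj₂ (i , a , q) | _     = inj₂ (suc i , a , q)
... | inj₁ ps          | no ¬a = inj₁ λ { zero a → contradiction a ¬a ; (suc i) → ps i }
... | inj₁ ps          | yes a with choose zero a
...   | inj₂ q = inj₂ (zero , a , q)
...   | inj₁ p = inj₁ λ { zero _ → p ; (suc i) → ps i }

∣p∪⁅x⁆∣≡1+∣p∣ : ∀ {n} (p : Subset n) x → x ∉ p → ∣ p ∪ ⁅ x ⁆ ∣ ≡ suc ∣ p ∣
∣p∪⁅x⁆∣≡1+∣p∣ (true  ∷ p) zero    x∉p = contradiction here x∉p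
∣p∪⁅x⁆∣≡1+∣p∣ (false ∷ p) zero    _   = cong (λ q → suc ∣ q ∣) (∪-identityʳ p)
∣p∪⁅x⁆∣≡1+∣p∣ (true  ∷ p) (suc x) x∉p = cong suc (∣p∪⁅x⁆∣≡1+∣p∣ p x (λ m → x∉p (there m)))
∣p∪⁅x⁆∣≡1+∣p∣ (false ∷ p) (suc x) x∉p = ∣p∪⁅x⁆∣≡1+∣p∣ p x (λ m → x∉p (there m))

1+∣p-x∣≡∣p∣ : ∀ {n} (p : Subset n) {x} → x ∈ p → suc ∣ p - x ∣ ≡ ∣ p ∣
1+∣p-x∣≡∣p∣ (true ∷ p) here      = cong (λ q → suc ∣ q ∣) (p─⊥≡p p)
1+∣p-x∣≡∣p∣ (true ∷ p) (there m) = cong suc (1+∣p-x∣≡∣p∣ p m)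
1+∣p-x∣≡∣p∣ (false ∷ p) (there m) = 1+∣p-x∣≡∣p∣ p m

x∉p-x : ∀ {n} (p : Subset n) x → x ∉ p - x
x∉p-x (_ ∷ p) zero    ()
x∉p-x (_ ∷ p) (suc x) (there m) = x∉p-x p x m

x∈p-y⁻ : ∀ {n} (p : Subset n) {x y} → x ∈ p - y → x ∈ p × x ≢ y
x∈p-y⁻ p {x} m = p─q⊆p p _ m , λ { refl → x∉p-x p x m }

x∉p-y⁻ : ∀ {n} (p : Subset n) {x y} → x ∉ p - y → x ∉ p ⊎ x ≡ y
x∉p-y⁻ p {x} {y} x∉p-y with x ≟ y
... | yes x≡y = inj₂ x≡y
... | no  x≢y = inj₁ (λ x∈p → x∉p-y (x∈p∧x≢y⇒x∈p-y x∈p x≢y))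

∣p∣+∣∁p∣≡n : ∀ {n} (p : Subset n) → ∣ p ∣ + ∣ ∁ p ∣ ≡ n
∣p∣+∣∁p∣≡n p = trans (cong (∣ p ∣ +_) (∣∁p∣≡n∸∣p∣ p)) (m+[n∸m]≡n (∣p∣≤n p))

x∈p∪⁅y⁆⁻ : ∀ {n} (p : Subset n) {x y} → x ∈ p ∪ ⁅ y ⁆ → x ∈ p ⊎ x ≡ y
x∈p∪⁅y⁆⁻ p {y = y} m = map₂ (x∈⁅y⁆⇒x≡y y) (x∈p∪q⁻ p ⁅ y ⁆ m)

-- `rank` numbers the members of p injectively by Fin ∣ p ∣ (to colour a
-- clique), and `element` enumerates them injectively (to bound a clique by the
-- number of colours).
rank : ∀ {n} (p : Subset n) {i} → i ∈ p → Fin ∣ p ∣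
rank (true  ∷ p) here      = zero
rank (true  ∷ p) (there m) = suc (rank p m)
rank (false ∷ p) (there m) = rank p m

rank-injective : ∀ {n} (p : Subset n) {i j} (i∈p : i ∈ p) (j∈p : j ∈ p) →
                 rank p i∈p ≡ rank p j∈p → i ≡ j
rank-injective (true  ∷ p) here      here      _ = refl
rank-injective (true  ∷ p) (there m) (there k) e = cong suc (rank-injective p m k (FinP.suc-injective e))
rank-injective (false ∷ p) (there m) (there k) e = cong suc (rank-injective p m k e)

element : ∀ {n} (p : Subset n) → Fin ∣ p ∣ → Fin n
element (true  ∷ p) zero    = zero
element (true  ∷ p) (suc i) = suc (element p i)
element (false ∷ p) i       = suc (element p i)

element∈p : ∀ {n} (p : Subset n) i → element p i ∈ p
element∈p (true  ∷ p) zero    = here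
element∈p (true  ∷ p) (suc i) = there (element∈p p i)
element∈p (false ∷ p) i       = there (element∈p p i)

element-injective : ∀ {n} (p : Subset n) {i j} → element p i ≡ element p j → i ≡ j
element-injective (true  ∷ p) {zero}  {zero}  _ = refl
element-injective (true  ∷ p) {suc i} {suc j} e = cong suc (element-injective p (FinP.suc-injective e))
element-injective (false ∷ p)                 e = element-injective p (FinP.suc-injective e)

adj⇒∈N : ∀ {n} (G : Graph n) {v j} → adj G v j ≡ true → j ∈ tabulate (adj G v)
adj⇒∈N G {v} {j} a = lookup⇒[]= j (tabulate (adj G v)) (trans (lookup∘tabulate (adj G v) j) a)

∈N⇒adj : ∀ {n} (G : Graph n) {v j} → j ∈ tabulate (adj G v) → adj G v j ≡ true
∈N⇒adj G {v} {j} m = trans (sym (lookup∘tabulate (adj G v) j)) ([]=⇒lookup m)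

≤deg : ∀ {n} (G : Graph n) v (P : Subset n) → (∀ j → j ∈ P → adj G v j ≡ true) → ∣ P ∣ ≤ deg G v
≤deg G v P nbrs = p⊆q⇒∣p∣≤∣q∣ (λ {j} j∈P → adj⇒∈N G (nbrs j j∈P))

deg≤ : ∀ {n} (G : Graph n) v (P : Subset n) → (∀ j → adj G v j ≡ true → j ∈ P) → deg G v ≤ ∣ P ∣
deg≤ G v P cover = p⊆q⇒∣p∣≤∣q∣ (λ {j} j∈N → cover j (∈N⇒adj G j∈N))

cadj-adjacent : ∀ {n} (G : Graph n) {i j} → adj G i j ≡ true → cadj G i j ≡ false
cadj-adjacent G {i} {j} a with i ≟ j
... | yes _ = refl
... | no  _ rewrite a = refl

cadj-nonadjacent : ∀ {n} (G : Graph n) {i j} → i ≢ j → adj G i j ≡ false → cadj G i j ≡ true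
cadj-nonadjacent G {i} {j} i≢j a with i ≟ j
... | yes i≡j = contradiction i≡j i≢j
... | no  _ rewrite a = refl

stable⇒co-clique : ∀ {n} (G : Graph n) {I} → IsStable G I → IsClique (complement G) I
stable⇒co-clique G I-stable i j i∈I j∈I i≢j = cadj-nonadjacent G i≢j (I-stable i j i∈I j∈I)

complement-KS : ∀ {n} (G : Graph n) {K} → IsKSPartition G K → IsKSPartition (complement G) (∁ K)
complement-KS G {K} (K-clique , S-stable) = stable⇒co-clique G S-stable , K-stable
  where
  inK : ∀ {i} → i ∈ ∁ (∁ K) → i ∈ K
  inK = x∉∁p⇒x∈p ∘ x∈∁p⇒x∉p
  K-stable : IsStable (complement G) (∁ (∁ K))
  K-stable i j i∈K j∈K = byCases (i ≟ j)
    where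
    byCases : Dec (i ≡ j) → cadj G i j ≡ false
    byCases (yes refl) = cadj-irrefl G i
    byCases (no  i≢j)  = cadj-adjacent G (K-clique i j (inK i∈K) (inK j∈K) i≢j)

-- A clique needs pairwise distinct colours.
cliqueBound : ∀ {n m} (H : Graph n) {Q} → IsClique H Q → Colouring H m → ∣ Q ∣ ≤ m
cliqueBound H {Q} Q-clique (c , proper) = injective⇒≤ distinct
  where
  distinct : ∀ {i j} → c (element Q i) ≡ c (element Q j) → i ≡ j
  distinct {i} {j} e with element Q i ≟ element Q j
  ... | yes same = element-injective Q same
  ... | no  diff = contradiction e (proper _ _ (Q-clique _ _ (element∈p Q i) (element∈p Q j) diff))

chromatic-unique : ∀ {n} (H : Graph n) {a b} → IsChromaticNumber H a → IsChromaticNumber H b → a ≡ b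
chromatic-unique H (colA , minA) (colB , minB) = ≤-antisym (minA _ colB) (minB _ colA)

-- If C is a clique whose complement is stable and every vertex outside C has a
-- non-neighbour in C, then χ(H) = |C|: colour each outside vertex like such a
-- non-neighbour.
splitChromatic : ∀ {n} (H : Graph n) (C : Subset n) → IsKSPartition H C →
                 (∀ s → s ∉ C → ∃[ k ] (k ∈ C × adj H s k ≡ false)) → IsChromaticNumber H ∣ C ∣
splitChromatic {n} H C (C-clique , S-stable) nonNeighbour =
  (colour , proper) , λ m col → cliqueBound H C-clique col
  where
  Represents : Fin n → Fin n → Set
  Represents k i = i ≡ k ⊎ (i ∉ C × adj H i k ≡ false)

  representative : ∀ i → ∃[ k ] (k ∈ C × Represents k i)
  representative i with i ∈? C
  ... | yes i∈C = i , i∈C , inj₁ refl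
  ... | no  i∉C with nonNeighbour i i∉C
  ...   | k , k∈C , a = k , k∈C , inj₂ (i∉C , a)

  colour : Fin n → Fin ∣ C ∣
  colour i = rank C (proj₁ (proj₂ (representative i)))

  shared : ∀ {i j k} → adj H i j ≡ true → Represents k i → Represents k j → ⊥
  shared {i} a (inj₁ refl) (inj₁ refl) = true≢false a (adj-irrefl H i)
  shared {i} {j} a (inj₁ refl) (inj₂ (_ , b)) = true≢false a (trans (adj-sym H i j) b)
  shared a (inj₂ (_ , b)) (inj₁ refl) = true≢false a b
  shared {i} {j} a (inj₂ (i∉C , _)) (inj₂ (j∉C , _)) =
    true≢false a (S-stable i j (x∉p⇒x∈∁p i∉C) (x∉p⇒x∈∁p j∉C))

  proper : ∀ i j → adj H i j ≡ true → colour i ≢ colour j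
  proper i j a e with representative i | representative j
  ... | k , k∈C , rᵢ | k′ , k′∈C , rⱼ =
    shared a rᵢ (subst (λ x → Represents x j) (sym (rank-injective C k∈C k′∈C e)) rⱼ)

Dominating : ∀ {n} → Graph n → Subset n → Fin n → Set
Dominating G K s = s ∉ K × (∀ k → k ∈ K → adj G s k ≡ true)

-- The KS-partition K admits no such vertex, and dually no vertex of K is
-- anticomplete to S; this is the balanced situation.
Tight : ∀ {n} → Graph n → Subset n → Set
Tight G K = (∀ s → s ∉ K → ∃[ k ] (k ∈ K × adj G s k ≡ false))
          × (∀ k → k ∈ K → ∃[ s ] (s ∉ K × adj G k s ≡ true))

dropIsolated : ∀ {n} (G : Graph n) {K k} → IsKSPartition G K → k ∈ K →
               (∀ s → s ∉ K → adj G k s ≡ false) → IsKSPartition G (K - k) × Dominating G (K - k) k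
dropIsolated G {K} {k} (K-clique , S-stable) k∈K isolated =
  (K′-clique , S′-stable) , x∉p-x K k , k-dominates
  where
  K′-clique : IsClique G (K - k)
  K′-clique i j i∈K′ j∈K′ = K-clique i j (proj₁ (x∈p-y⁻ K i∈K′)) (proj₁ (x∈p-y⁻ K j∈K′))
  S′-stable : IsStable G (∁ (K - k))
  S′-stable i j i∈S′ j∈S′ with x∉p-y⁻ K (x∈∁p⇒x∉p i∈S′) | x∉p-y⁻ K (x∈∁p⇒x∉p j∈S′)
  ... | inj₁ i∉K | inj₁ j∉K = S-stable i j (x∉p⇒x∈∁p i∉K) (x∉p⇒x∈∁p j∉K)
  ... | inj₂ refl | inj₁ j∉K = isolated j j∉K
  ... | inj₁ i∉K | inj₂ refl = trans (adj-sym G i k) (isolated i i∉K)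
  ... | inj₂ refl | inj₂ refl = adj-irrefl G i
  k-dominates : ∀ x → x ∈ K - k → adj G k x ≡ true
  k-dominates x x∈K′ with x∈p-y⁻ K x∈K′
  ... | x∈K , x≢k = K-clique k x k∈K x∈K (λ k≡x → x≢k (sym k≡x))

dominatesOrMisses : ∀ {n} (G : Graph n) (K : Subset n) s →
                    ∃[ k ] (k ∈ K × adj G s k ≡ false) ⊎ (∀ k → k ∈ K → adj G s k ≡ true)
dominatesOrMisses G K s = swap (allOrSome (_∈? K) (λ k _ → true-or-false (adj G s k)))

reachesOrIsolated : ∀ {n} (G : Graph n) (K : Subset n) k →
                    ∃[ s ] (s ∉ K × adj G k s ≡ true) ⊎ (∀ s → s ∉ K → adj G k s ≡ false)
reachesOrIsolated G K k = swap (allOrSome (¬? ∘ (_∈? K)) (λ s _ → swap (true-or-false (adj G k s))))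

splitShape : ∀ {n} (G : Graph n) {K} → IsKSPartition G K →
             (∃[ K′ ] ∃[ s ] (IsKSPartition G K′ × Dominating G K′ s)) ⊎ Tight G K
splitShape G {K} part with allOrSome (¬? ∘ (_∈? K)) (λ s _ → dominatesOrMisses G K s)
... | inj₂ (s , s∉K , dom) = inj₁ (K , s , part , s∉K , dom)
... | inj₁ misses with allOrSome (_∈? K) (λ k _ → reachesOrIsolated G K k)
...   | inj₂ (k , k∈K , isolated) = inj₁ (K - k , k , dropIsolated G part k∈K isolated)
...   | inj₁ reaches              = inj₂ (misses , reaches)

-- In a balanced split graph every clique and stable set together have at most
-- n vertices, since ω + α = |K| + |S| = n.
balancedBound : ∀ {n} (G : Graph n) {Q I} → IsBalanced G → IsClique G Q → IsStable G I → ∣ Q ∣ + ∣ I ∣ ≤ n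
balancedBound G {Q} {I} (_ , K , _ , (_ , ω-max) , (_ , α-max)) Q-clique I-stable =
  subst (∣ Q ∣ + ∣ I ∣ ≤_) (∣p∣+∣∁p∣≡n K) (+-mono-≤ (ω-max _ Q-clique) (α-max _ I-stable))

module Dominated {n} (G : Graph n) (K : Subset n) (part : IsKSPartition G K)
                 (s : Fin n) (dom : Dominating G K s) where

  K-clique : IsClique G K
  K-clique = proj₁ part

  S-stable : IsStable G (∁ K)
  S-stable = proj₂ part

  s∉K : s ∉ K
  s∉K = proj₁ dom

  s-dominates : ∀ k → k ∈ K → adj G s k ≡ true
  s-dominates = proj₂ dom

  stable-in-S : ∀ {i j} → i ∉ K → j ∉ K → adj G i j ≡ false
  stable-in-S i∉K j∉K = S-stable _ _ (x∉p⇒x∈∁p i∉K) (x∉p⇒x∈∁p j∉K)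

  K⁺ : Subset n
  K⁺ = K ∪ ⁅ s ⁆

  ∣K⁺∣ : ∣ K⁺ ∣ ≡ suc ∣ K ∣
  ∣K⁺∣ = ∣p∪⁅x⁆∣≡1+∣p∣ K s s∉K

  K⊆K⁺ : ∀ {i} → i ∈ K → i ∈ K⁺
  K⊆K⁺ i∈K = x∈p∪q⁺ (inj₁ i∈K)

  s∈K⁺ : s ∈ K⁺
  s∈K⁺ = x∈p∪q⁺ (inj₂ (x∈⁅x⁆ s))

  K⁺-clique : IsClique G K⁺
  K⁺-clique i j i∈K⁺ j∈K⁺ i≢j with x∈p∪⁅y⁆⁻ K i∈K⁺ | x∈p∪⁅y⁆⁻ K j∈K⁺
  ... | inj₁ i∈K  | inj₁ j∈K  = K-clique i j i∈K j∈K i≢j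
  ... | inj₁ i∈K  | inj₂ refl = trans (adj-sym G i j) (s-dominates i i∈K)
  ... | inj₂ refl | inj₁ j∈K  = s-dominates j j∈K
  ... | inj₂ refl | inj₂ refl = contradiction refl i≢j

  K⁺-partition : IsKSPartition G K⁺
  K⁺-partition = K⁺-clique , λ i j i∉K⁺ j∉K⁺ → stable-in-S (outside i∉K⁺) (outside j∉K⁺)
    where
    outside : ∀ {i} → i ∈ ∁ K⁺ → i ∉ K
    outside i∉K⁺ = x∈∁p⇒x∉p i∉K⁺ ∘ K⊆K⁺

  -- χ(G) = |K⁺|, since every vertex of S - s misses s ∈ K⁺.
  χ[G] : IsChromaticNumber G (suc ∣ K ∣)
  χ[G] = subst (IsChromaticNumber G) ∣K⁺∣ (splitChromatic G K⁺ K⁺-partition missesS)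
    where
    missesS : ∀ t → t ∉ K⁺ → ∃[ k ] (k ∈ K⁺ × adj G t k ≡ false)
    missesS t t∉K⁺ = s , s∈K⁺ , stable-in-S (t∉K⁺ ∘ K⊆K⁺) s∉K

  -- χ(Ḡ) = |S|, since in Ḡ every vertex of K misses s ∈ S.
  χ[Ḡ] : IsChromaticNumber (complement G) ∣ ∁ K ∣
  χ[Ḡ] = splitChromatic (complement G) (∁ K) (complement-KS G part) missesS
    where
    missesS : ∀ k → k ∉ ∁ K → ∃[ t ] (t ∈ ∁ K × cadj G k t ≡ false)
    missesS k k∉S = s , x∉p⇒x∈∁p s∉K ,
                    cadj-adjacent G (trans (adj-sym G k s) (s-dominates k (x∉∁p⇒x∈p k∉S)))

  isNG : IsNG G
  isNG = suc ∣ K ∣ , ∣ ∁ K ∣ , χ[G] , χ[Ḡ] , trans (cong suc (∣p∣+∣∁p∣≡n K)) (+-comm 1 n)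

  -- ω + α ≥ |K⁺| + |S| = n + 1, which no balanced split graph allows.
  unbalanced : IsUnbalanced G
  unbalanced = (K , part) , λ balanced →
    1+n≰n (subst (_≤ n) size (balancedBound G balanced K⁺-clique S-stable))
    where
    size : ∣ K⁺ ∣ + ∣ ∁ K ∣ ≡ suc n
    size = trans (cong (_+ ∣ ∁ K ∣) ∣K⁺∣) (cong suc (∣p∣+∣∁p∣≡n K))

  -- A vertex v ∈ K with a neighbour t ∈ S other than s sees K⁺ - v and t,
  -- so its degree exceeds |K|.
  highDegree : ∀ {v t} → v ∈ K → t ∉ K → t ≢ s → adj G v t ≡ true → suc ∣ K ∣ ≤ deg G v
  highDegree {v} {t} v∈K t∉K t≢s v~t =
    subst (_≤ deg G v) size (≤deg G v ((K⁺ - v) ∪ ⁅ t ⁆) neighbour)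
    where
    t∉K⁺-v : t ∉ K⁺ - v
    t∉K⁺-v t∈K⁺-v with x∈p∪⁅y⁆⁻ K (proj₁ (x∈p-y⁻ K⁺ t∈K⁺-v))
    ... | inj₁ t∈K = t∉K t∈K
    ... | inj₂ t≡s = t≢s t≡s
    size : ∣ (K⁺ - v) ∪ ⁅ t ⁆ ∣ ≡ suc ∣ K ∣
    size = begin
      ∣ (K⁺ - v) ∪ ⁅ t ⁆ ∣ ≡⟨ ∣p∪⁅x⁆∣≡1+∣p∣ (K⁺ - v) t t∉K⁺-v ⟩
      suc ∣ K⁺ - v ∣       ≡⟨ 1+∣p-x∣≡∣p∣ K⁺ (K⊆K⁺ v∈K) ⟩
      ∣ K⁺ ∣               ≡⟨ ∣K⁺∣ ⟩
      suc ∣ K ∣            ∎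
    neighbour : ∀ j → j ∈ (K⁺ - v) ∪ ⁅ t ⁆ → adj G v j ≡ true
    neighbour j j∈P with x∈p∪⁅y⁆⁻ (K⁺ - v) j∈P
    ... | inj₂ refl = v~t
    ... | inj₁ j∈K⁺-v with x∈p-y⁻ K⁺ j∈K⁺-v
    ...   | j∈K⁺ , j≢v = K⁺-clique v j (K⊆K⁺ v∈K) j∈K⁺ (j≢v ∘ sym)

  -- A vertex t ∈ S missing v ∈ K has all its neighbours in K - v.
  lowDegree : ∀ {t v} → t ∉ K → v ∈ K → adj G t v ≡ false → deg G t < ∣ K ∣
  lowDegree {t} {v} t∉K v∈K t≁v =
    ≤-<-trans (deg≤ G t (K - v) inK-v) (x∈p⇒∣p-x∣<∣p∣ v∈K)
    where
    inK-v : ∀ j → adj G t j ≡ true → j ∈ K - v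
    inK-v j t~j with j ∈? K | j ≟ v
    ... | no  j∉K | _        = ⊥-elim (true≢false t~j (stable-in-S t∉K j∉K))
    ... | yes _   | yes refl = ⊥-elim (true≢false t~j t≁v)
    ... | yes j∈K | no  j≢v  = x∈p∧x≢y⇒x∈p-y j∈K j≢v

  noDegreeKOnBothSides : ∀ {v t} → v ∈ K → t ∉ K → t ≢ s → deg G v ≡ ∣ K ∣ → deg G t ≡ ∣ K ∣ → ⊥
  noDegreeKOnBothSides {v} {t} v∈K t∉K t≢s dv dt with true-or-false (adj G v t)
  ... | inj₁ v~t = 1+n≰n (subst (suc ∣ K ∣ ≤_) dv (highDegree v∈K t∉K t≢s v~t))
  ... | inj₂ v≁t = <-irrefl dt (lowDegree t∉K v∈K (trans (adj-sym G t v) v≁t))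

  -- Since χ(G) = |K| + 1, the set A consists of the vertices of degree |K|.
  inA⇒degree : ∀ {k u} → IsChromaticNumber G k → InA G k u → deg G u ≡ ∣ K ∣
  inA⇒degree {k} {u} χk u∈A = suc-injective (begin
    suc (deg G u) ≡⟨ +-comm 1 (deg G u) ⟩
    deg G u + 1   ≡⟨ u∈A ⟩
    k             ≡⟨ chromatic-unique G χk χ[G] ⟩
    suc ∣ K ∣     ∎)

  -- If some vertex of K lies in A then A ⊆ K⁺ is a clique; otherwise A ⊆ S is stable.
  isNG1⊎NG2 : IsNG1 G ⊎ IsNG2 G
  isNG1⊎NG2 with allOrSome (_∈? K) (λ v _ → swap (toSum (deg G v ℕ.≟ ∣ K ∣)))
  ... | inj₂ (v , v∈K , dv) = inj₁ (isNG , λ k χ u w u∈A w∈A →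
          K⁺-clique u w (inK⁺ (inA⇒degree χ u∈A)) (inK⁺ (inA⇒degree χ w∈A)))
    where
    inK⁺ : ∀ {u} → deg G u ≡ ∣ K ∣ → u ∈ K⁺
    inK⁺ {u} du with u ∈? K | u ≟ s
    ... | yes u∈K | _        = K⊆K⁺ u∈K
    ... | no  _   | yes refl = s∈K⁺
    ... | no  u∉K | no  u≢s  = ⊥-elim (noDegreeKOnBothSides v∈K u∉K u≢s dv du)
  ... | inj₁ noneInK = inj₂ (isNG , λ k χ u w u∈A w∈A →
          stable-in-S (inS (inA⇒degree χ u∈A)) (inS (inA⇒degree χ w∈A)))
    where
    inS : ∀ {u} → deg G u ≡ ∣ K ∣ → u ∉ K
    inS du u∈K = noneInK _ u∈K du

module TightSplit {n} (G : Graph n) (K : Subset n) (part : IsKSPartition G K) (tight : Tight G K) where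

  χ[G] : IsChromaticNumber G ∣ K ∣
  χ[G] = splitChromatic G K part (proj₁ tight)

  -- in Ḡ, a vertex of K misses its G-neighbour in S
  χ[Ḡ] : IsChromaticNumber (complement G) ∣ ∁ K ∣
  χ[Ḡ] = splitChromatic (complement G) (∁ K) (complement-KS G part) missesS
    where
    missesS : ∀ k → k ∉ ∁ K → ∃[ t ] (t ∈ ∁ K × cadj G k t ≡ false)
    missesS k k∉S with proj₂ tight k (x∉∁p⇒x∈p k∉S)
    ... | t , t∉K , k~t = t , x∉p⇒x∈∁p t∉K , cadj-adjacent G k~t

  notNG : ¬ IsNG G
  notNG (k , l , χk , χl , k+l≡n+1) = 1+n≰n (≤-reflexive (begin
    suc n             ≡⟨ +-comm 1 n ⟩
    n + 1             ≡⟨ k+l≡n+1 ⟨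
    k + l             ≡⟨ cong₂ _+_ (chromatic-unique G χk χ[G]) (chromatic-unique (complement G) χl χ[Ḡ]) ⟩
    ∣ K ∣ + ∣ ∁ K ∣   ≡⟨ ∣p∣+∣∁p∣≡n K ⟩
    n                 ∎))

  -- cliques of G and of Ḡ are bounded by the colourings above
  balanced : IsBalanced G
  balanced = (K , part) , K , part ,
             ((K , proj₁ part , refl) , λ Q Q-clique → cliqueBound G Q-clique (proj₁ χ[G])) ,
             ((∁ K , proj₂ part , refl) ,
              λ I I-stable → cliqueBound (complement G) (stable⇒co-clique G I-stable) (proj₁ χ[Ḡ]))

theorem2p3 : ∀ {n} (G : Graph n) → IsSplit G →
               (IsNG G ⇔ (IsNG1 G ⊎ IsNG2 G)) × (IsNG G ⇔ IsUnbalanced G)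
theorem2p3 G (K , part) with splitShape G part
... | inj₁ (K′ , s , part′ , dom) =
  mk⇔ (λ _ → isNG1⊎NG2) [ proj₁ , proj₁ ] , mk⇔ (λ _ → unbalanced) (λ _ → isNG)
  where open Dominated G K′ part′ s dom
... | inj₂ tight =
  mk⇔ (⊥-elim ∘ notNG) [ proj₁ , proj₁ ] ,
  mk⇔ (⊥-elim ∘ notNG) (λ (_ , unbal) → ⊥-elim (unbal balanced))
  where open TightSplit G K part tight
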